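{- Let $k \ge 2$ and let $\lambda_1, \dots, \lambda_{k-1}$ be positive integers. Let $\mathcal{H}$ be a $k$-graph with $m$ edges that contains no copy of any of $S^k_{\lambda_1}(k-1), S^k_{\lambda_2}(k-2), \dots, S^k_{\lambda_{k-1}}(1)$ (i.e., no copy of $S^k_{\lambda_i}(k-i)$ for $i \in [k-1]$). Then $$\nu(\mathcal{H}) \ge \frac{m}{\prod_{i=1}^{k-1} (i+1)\lambda_i}.$$
   Context: A $k$-graph is a family of $k$-element subsets (edges) of a finite vertex set. For $k > \ell \ge 1$ and $\lambda \ge 1$, $S^k_{\lambda}(\ell)$ is the $k$-graph consisting of $\lambda$ edges $E_1,\dots,E_\lambda$ with $E_i \cap E_j = S$ for all $i<j$, for a fixed $\ell$-set $S$. $\nu(\mathcal{H})$ is the maximum number of pairwise disjoint edges of $\mathcal{H}$. -}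

module Defs where

open import Data.Nat using (ℕ; zero; suc; _*_; _≤_; _∸_)
open import Data.Fin.Subset using (Subset; _∩_; ∣_∣; ⊥)
open import Data.List using (List; length)
open import Data.List.Relation.Unary.All using (All)
open import Data.List.Relation.Unary.AllPairs using (AllPairs)
open import Data.List.Relation.Unary.Unique.Propositional using (Unique)
open import Data.List.Membership.Propositional using (_∈_)
open import Data.Product using (Σ; _×_)
open import Relation.Binary.PropositionalEquality using (_≡_)

record KGraph (k n : ℕ) : Set where
  field
    edges    : List (Subset n)
    unique   : Unique edges
    uniform  : All (λ E → ∣ E ∣ ≡ k) edges

open KGraph public

numEdges : ∀ {k n} → KGraph k n → ℕ
numEdges H = length (edges H)

-- H contains a copy of S^k_λ(ℓ): λ edges of H whose pairwise
-- intersections all equal one fixed ℓ-set S.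
-- (Pairwise intersection S with |S| = ℓ < k forces the edges to be distinct.)
HasSunflower : ∀ {k n} → KGraph k n → (lam ℓ : ℕ) → Set
HasSunflower {n = n} H lam ℓ =
  Σ (Subset n) λ S → Σ (List (Subset n)) λ L →
    ∣ S ∣ ≡ ℓ × length L ≡ lam × All (_∈ edges H) L
      × AllPairs (λ E F → E ∩ F ≡ S) L

HasMatchingOfSize : ∀ {k n} → KGraph k n → ℕ → Set
HasMatchingOfSize {n = n} H t =
  Σ (List (Subset n)) λ M →
    length M ≡ t × All (_∈ edges H) M × AllPairs (λ E F → E ∩ F ≡ ⊥) M

prodFactor : (ℕ → ℕ) → ℕ → ℕ
prodFactor lam zero    = 1
prodFactor lam (suc j) = prodFactor lam j * (suc (suc j) * lam (suc j))

-- Let d(S) be the number of edges containing S and Q(j) = ∏_{i ≤ j} i λ_i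
-- (degreeBound).  Every (k - j)-set S has d(S) ≤ Q(j), by induction on j:
-- greedily choose a maximal sunflower with kernel S among the edges through S;
-- it has fewer than λ_j petals.  By maximality, every edge F ⊇ S meets some
-- petal E in more than S, so F contains one of the j sets S ∪ {x}, x ∈ E ∖ S,
-- each of degree at most Q(j - 1).  Hence d(S) ≤ λ_j · j · Q(j - 1).
-- The same argument with the empty kernel, where the greedy sunflower is a
-- maximal matching M, gives m = d(∅) ≤ |M| · k · Q(k - 1) = |M| ∏ (i+1) λ_i.
module Submission where

open import Defs
open import Data.Bool.Base using (true; false)
import Data.Bool.Properties as Bool
open import Data.Empty using (⊥-elim)
open import Data.Fin.Subset using (Subset; inside; outside; _⊆_; _∩_; ∣_∣; ⊥)
open import Data.Fin.Subset.Properties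
  using (_⊆?_; drop-∷-⊆; in⊆in; out⊆; ⊆-min; p⊆q⇒∣p∣≤∣q∣; ∩-idem; ∣⊥∣≡0)
open import Data.List.Base using (List; []; _∷_; length; map; filter; take; concatMap)
open import Data.List.Properties using (length-map; length-++; length-take; filter-all; filter-accept)
open import Data.List.Membership.Propositional using (_∈_; find; lose)
open import Data.List.Relation.Unary.All as All using (All; []; _∷_; all?)
import Data.List.Relation.Unary.All.Properties as All
open import Data.List.Relation.Unary.AllPairs using (AllPairs; []; _∷_)
import Data.List.Relation.Unary.AllPairs.Properties as AllPairs
open import Data.List.Relation.Unary.Any as Any using (Any; here; there)
import Data.List.Relation.Unary.Any.Properties as Any
open import Data.List.Relation.Unary.Unique.Propositional using (Unique)
import Data.List.Relation.Unary.Unique.Propositional.Properties as Unique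
open import Data.Nat.Base using (ℕ; zero; suc; _+_; _*_; _∸_; _≤_; _<_; z≤n; s≤s)
open import Data.Nat.ListAction using (sum)
open import Data.Nat.Properties
  using ( suc-injective; ≤-refl; ≤-reflexive; ≤-trans; n≤1+n; ≤⇒≯; <⇒≤; _≤?_; ≰⇒>
        ; +-comm; +-suc; +-identityʳ; +-cancelʳ-≡; m+1+n≢m; *-assoc
        ; +-mono-≤; +-monoʳ-≤; *-monoˡ-≤; m+n∸n≡m; m+[n∸m]≡n; m≤n⇒m⊓n≡m
        ; module ≤-Reasoning )
open import Data.Nat.Tactic.RingSolver using (solve-∀)
open import Data.Product.Base using (Σ; _×_; _,_)
import Data.Vec.Base as Vec
open import Data.Vec.Properties using (≡-dec)
open import Function.Base using (_∘_; id)
open import Relation.Binary.Definitions using (DecidableEquality)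
open import Relation.Binary.PropositionalEquality
open import Relation.Nullary using (¬_; yes; no; does)
open import Relation.Nullary.Decidable using (_×-dec_)
open import Relation.Unary using (Pred; Decidable)

infix 4 _≟_
_≟_ : ∀ {n} → DecidableEquality (Subset n)
_≟_ = ≡-dec Bool._≟_

inside⊈outside : ∀ {n} {p q : Subset n} → ¬ (inside Vec.∷ p ⊆ outside Vec.∷ q)
inside⊈outside p⊆q with p⊆q Vec.here
... | ()

p⊆q∧∣p∣≡∣q∣⇒p≡q : ∀ {n} {p q : Subset n} → p ⊆ q → ∣ p ∣ ≡ ∣ q ∣ → p ≡ q
p⊆q∧∣p∣≡∣q∣⇒p≡q {p = Vec.[]} {Vec.[]} _ _ = refl
p⊆q∧∣p∣≡∣q∣⇒p≡q {p = inside Vec.∷ p} {inside Vec.∷ q} p⊆q eq =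
  cong (inside Vec.∷_) (p⊆q∧∣p∣≡∣q∣⇒p≡q (drop-∷-⊆ p⊆q) (suc-injective eq))
p⊆q∧∣p∣≡∣q∣⇒p≡q {p = inside Vec.∷ p} {outside Vec.∷ q} p⊆q _ = ⊥-elim (inside⊈outside p⊆q)
p⊆q∧∣p∣≡∣q∣⇒p≡q {p = outside Vec.∷ p} {inside Vec.∷ q} p⊆q eq =
  ⊥-elim (≤⇒≯ (p⊆q⇒∣p∣≤∣q∣ (drop-∷-⊆ p⊆q)) (≤-reflexive (sym eq)))
p⊆q∧∣p∣≡∣q∣⇒p≡q {p = outside Vec.∷ p} {outside Vec.∷ q} p⊆q eq =
  cong (outside Vec.∷_) (p⊆q∧∣p∣≡∣q∣⇒p≡q (drop-∷-⊆ p⊆q) eq)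

-- The sets S ∪ {x} for x ∈ E ∖ S.
extensions : ∀ {n} → Subset n → Subset n → List (Subset n)
extensions Vec.[]              Vec.[]              = []
extensions (inside Vec.∷ S)    (_ Vec.∷ E)         = map (inside Vec.∷_) (extensions S E)
extensions (outside Vec.∷ S)   (inside Vec.∷ E)    =
  (inside Vec.∷ S) ∷ map (outside Vec.∷_) (extensions S E)
extensions (outside Vec.∷ S)   (outside Vec.∷ E)   = map (outside Vec.∷_) (extensions S E)

∣extensions∣ : ∀ {n} (S E : Subset n) → All (λ T → ∣ T ∣ ≡ suc ∣ S ∣) (extensions S E)
∣extensions∣ Vec.[]            Vec.[]            = []
∣extensions∣ (inside Vec.∷ S)  (_ Vec.∷ E)       = All.map⁺ (All.map (cong suc) (∣extensions∣ S E))
∣extensions∣ (outside Vec.∷ S) (inside Vec.∷ E)  = refl ∷ All.map⁺ (∣extensions∣ S E)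
∣extensions∣ (outside Vec.∷ S) (outside Vec.∷ E) = All.map⁺ (∣extensions∣ S E)

length-extensions : ∀ {n} {S E : Subset n} → S ⊆ E → length (extensions S E) + ∣ S ∣ ≡ ∣ E ∣
length-extensions {S = Vec.[]} {Vec.[]} _ = refl
length-extensions {S = inside Vec.∷ S} {inside Vec.∷ E} S⊆E
  rewrite length-map (inside Vec.∷_) (extensions S E) | +-suc (length (extensions S E)) ∣ S ∣
  = cong suc (length-extensions (drop-∷-⊆ S⊆E))
length-extensions {S = inside Vec.∷ S} {outside Vec.∷ E} S⊆E = ⊥-elim (inside⊈outside S⊆E)
length-extensions {S = outside Vec.∷ S} {inside Vec.∷ E} S⊆E
  rewrite length-map (outside Vec.∷_) (extensions S E)
  = cong suc (length-extensions (drop-∷-⊆ S⊆E))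
length-extensions {S = outside Vec.∷ S} {outside Vec.∷ E} S⊆E
  rewrite length-map (outside Vec.∷_) (extensions S E)
  = length-extensions (drop-∷-⊆ S⊆E)

extension-⊆ : ∀ {n} {S E F : Subset n} → S ⊆ E → S ⊆ F → F ∩ E ≢ S →
              Any (_⊆ F) (extensions S E)
extension-⊆ {S = Vec.[]} {Vec.[]} {Vec.[]} _ _ F∩E≢S = ⊥-elim (F∩E≢S refl)
extension-⊆ {S = inside Vec.∷ S} {outside Vec.∷ E} S⊆E _ _ = ⊥-elim (inside⊈outside S⊆E)
extension-⊆ {S = inside Vec.∷ S} {inside Vec.∷ E} {outside Vec.∷ F} _ S⊆F _ =
  ⊥-elim (inside⊈outside S⊆F)
extension-⊆ {S = inside Vec.∷ S} {inside Vec.∷ E} {inside Vec.∷ F} S⊆E S⊆F F∩E≢S =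
  Any.map⁺ (Any.map in⊆in
    (extension-⊆ (drop-∷-⊆ S⊆E) (drop-∷-⊆ S⊆F) (F∩E≢S ∘ cong (inside Vec.∷_))))
extension-⊆ {S = outside Vec.∷ S} {inside Vec.∷ E} {inside Vec.∷ F} _ S⊆F _ =
  here (in⊆in (drop-∷-⊆ S⊆F))
extension-⊆ {S = outside Vec.∷ S} {inside Vec.∷ E} {outside Vec.∷ F} S⊆E S⊆F F∩E≢S =
  there (Any.map⁺ (Any.map out⊆
    (extension-⊆ (drop-∷-⊆ S⊆E) (drop-∷-⊆ S⊆F) (F∩E≢S ∘ cong (outside Vec.∷_)))))
extension-⊆ {S = outside Vec.∷ S} {outside Vec.∷ E} {inside Vec.∷ F} S⊆E S⊆F F∩E≢S =
  Any.map⁺ (Any.map out⊆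
    (extension-⊆ (drop-∷-⊆ S⊆E) (drop-∷-⊆ S⊆F) (F∩E≢S ∘ cong (outside Vec.∷_))))
extension-⊆ {S = outside Vec.∷ S} {outside Vec.∷ E} {outside Vec.∷ F} S⊆E S⊆F F∩E≢S =
  Any.map⁺ (Any.map out⊆
    (extension-⊆ (drop-∷-⊆ S⊆E) (drop-∷-⊆ S⊆F) (F∩E≢S ∘ cong (outside Vec.∷_))))

length-filter-∷ : ∀ {a p} {A : Set a} {P : Pred A p} (P? : Decidable P) x xs →
                  length (filter P? xs) ≤ length (filter P? (x ∷ xs))
length-filter-∷ P? x xs with does (P? x)
... | true  = n≤1+n _
... | false = ≤-refl

sum-map-mono : ∀ {b} {B : Set b} {f g : B → ℕ} → (∀ w → f w ≤ g w) →
               ∀ ws → sum (map f ws) ≤ sum (map g ws)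
sum-map-mono f≤g []       = z≤n
sum-map-mono f≤g (w ∷ ws) = +-mono-≤ (f≤g w) (sum-map-mono f≤g ws)

sum-map-≤-length-* : ∀ {b} {B : Set b} {f : B → ℕ} {c} ws → All (λ w → f w ≤ c) ws →
                     sum (map f ws) ≤ length ws * c
sum-map-≤-length-* []       []           = z≤n
sum-map-≤-length-* (w ∷ ws) (fw≤c ∷ f≤c) = +-mono-≤ fw≤c (sum-map-≤-length-* ws f≤c)

length-concatMap : ∀ {a b} {A : Set a} {B : Set b} {f : A → List B} {c} xs →
                   All (λ x → length (f x) ≡ c) xs → length (concatMap f xs) ≡ length xs * c
length-concatMap         []       []          = refl
length-concatMap {f = f} (x ∷ xs) (∣fx∣≡c ∷ ∣f∣≡c) =
  trans (length-++ (f x)) (cong₂ _+_ ∣fx∣≡c (length-concatMap xs ∣f∣≡c))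

module _ {a b p r} {A : Set a} {B : Set b} {P : Pred A p} {R : B → A → Set r}
         (P? : Decidable P) (R? : ∀ w → Decidable (R w)) where

  private
    count : B → List A → ℕ
    count w xs = length (filter (R? w) xs)

  sum-count-∷ : ∀ x xs ws → Any (λ w → R w x) ws →
                suc (sum (map (λ w → count w xs) ws)) ≤ sum (map (λ w → count w (x ∷ xs)) ws)
  sum-count-∷ x xs (w ∷ ws) (here Rwx) rewrite filter-accept (R? w) {xs = xs} Rwx =
    s≤s (+-monoʳ-≤ (count w xs) (sum-map-mono (λ v → length-filter-∷ (R? v) x xs) ws))
  sum-count-∷ x xs (w ∷ ws) (there Rx) =
    ≤-trans (≤-reflexive (sym (+-suc (count w xs) _)))
            (+-mono-≤ (length-filter-∷ (R? w) x xs) (sum-count-∷ x xs ws Rx))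

  length-filter-≤-sum : ∀ ws xs → All (λ x → P x → Any (λ w → R w x) ws) xs →
                        length (filter P? xs) ≤ sum (map (λ w → count w xs) ws)
  length-filter-≤-sum ws []       []             = z≤n
  length-filter-≤-sum ws (x ∷ xs) (covered ∷ cs) with P? x
  ... | yes Px = ≤-trans (s≤s (length-filter-≤-sum ws xs cs)) (sum-count-∷ x xs ws (covered Px))
  ... | no  _  = ≤-trans (length-filter-≤-sum ws xs cs)
                         (sum-map-mono (λ w → length-filter-∷ (R? w) x xs) ws)

Unique∧All≡⇒length≤1 : ∀ {a} {A : Set a} {x : A} {xs} →
                       Unique xs → All (_≡ x) xs → length xs ≤ 1
Unique∧All≡⇒length≤1 {xs = []}         _ _ = z≤n
Unique∧All≡⇒length≤1 {xs = _ ∷ []}     _ _ = s≤s z≤n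
Unique∧All≡⇒length≤1 {xs = _ ∷ _ ∷ _} ((y≢z ∷ _) ∷ _) (y≡x ∷ z≡x ∷ _) =
  ⊥-elim (y≢z (trans y≡x (sym z≡x)))

module _ {n} (S : Subset n) where

  Compatible : List (Subset n) → Subset n → Set
  Compatible Es F = S ⊆ F × All (λ E → F ∩ E ≡ S) Es

  compatible? : ∀ Es → Decidable (Compatible Es)
  compatible? Es F = S ⊆? F ×-dec all? (λ E → F ∩ E ≟ S) Es

  petals : List (Subset n) → List (Subset n)
  petals []       = []
  petals (F ∷ Fs) with compatible? (petals Fs) F
  ... | yes _ = F ∷ petals Fs
  ... | no  _ = petals Fs

  petals-sunflower : ∀ Fs → AllPairs (λ E F → E ∩ F ≡ S) (petals Fs)
  petals-sunflower []       = []
  petals-sunflower (F ∷ Fs) with compatible? (petals Fs) F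
  ... | yes (_ , F∩petals≡S) = F∩petals≡S ∷ petals-sunflower Fs
  ... | no  _                = petals-sunflower Fs

  All-petals : ∀ {p} {P : Pred (Subset n) p} {Fs} → All P Fs → All P (petals Fs)
  All-petals {Fs = []}     []         = []
  All-petals {Fs = F ∷ Fs} (PF ∷ PFs) with compatible? (petals Fs) F
  ... | yes _ = PF ∷ All-petals PFs
  ... | no  _ = All-petals PFs

  ⊆-petals : ∀ Fs → All (S ⊆_) (petals Fs)
  ⊆-petals []       = []
  ⊆-petals (F ∷ Fs) with compatible? (petals Fs) F
  ... | yes (S⊆F , _) = S⊆F ∷ ⊆-petals Fs
  ... | no  _         = ⊆-petals Fs

  petals-maximal : ∀ Fs → All (λ F → S ⊆ F → F ≢ S → Any (λ E → F ∩ E ≢ S) (petals Fs)) Fs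
  petals-maximal []       = []
  petals-maximal (F ∷ Fs) with compatible? (petals Fs) F
  ... | yes _ = (λ _ F≢S → here (F≢S ∘ trans (sym (∩-idem F))))
              ∷ All.map (λ {G} maximal (S⊆G : S ⊆ G) G≢S → there (maximal S⊆G G≢S)) (petals-maximal Fs)
  ... | no ¬compatible = (λ S⊆F _ → All.¬All⇒Any¬ (λ E → F ∩ E ≟ S) (petals Fs)
                                      (λ F∩petals≡S → ¬compatible (S⊆F , F∩petals≡S)))
                       ∷ petals-maximal Fs

degree : ∀ {k n} → KGraph k n → Subset n → ℕ
degree H S = length (filter (S ⊆?_) (edges H))

module _ {k n} (H : KGraph k n) where

  degree-≤-1 : ∀ S → ∣ S ∣ ≡ k → degree H S ≤ 1
  degree-≤-1 S ∣S∣≡k = Unique∧All≡⇒length≤1 (Unique.filter⁺ (S ⊆?_) (unique H))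
    (All.zipWith edge≡S (All.filter⁺ (S ⊆?_) (uniform H) , All.all-filter (S ⊆?_) (edges H)))
    where
    edge≡S : ∀ {F} → ∣ F ∣ ≡ k × S ⊆ F → F ≡ S
    edge≡S (∣F∣≡k , S⊆F) = sym (p⊆q∧∣p∣≡∣q∣⇒p≡q S⊆F (trans ∣S∣≡k (sym ∣F∣≡k)))

  degree-≤-petals : ∀ S d {D} → ∣ S ∣ + suc d ≡ k →
                    (∀ T → ∣ T ∣ ≡ suc ∣ S ∣ → degree H T ≤ D) →
                    degree H S ≤ length (petals S (edges H)) * (suc d * D)
  degree-≤-petals S d {D} ∣S∣+d+1≡k degree-≤-D = begin
    degree H S              ≤⟨ length-filter-≤-sum (S ⊆?_) _⊆?_ W (edges H) covered ⟩
    sum (map (degree H) W)  ≤⟨ sum-map-≤-length-* W (All.map (degree-≤-D _) ∣W∣) ⟩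
    length W * D            ≡⟨ cong (_* D) (length-concatMap L (All.zipWith length-extension-petal
                                 (⊆-petals S (edges H) , All-petals S (uniform H)))) ⟩
    length L * suc d * D    ≡⟨ *-assoc (length L) (suc d) D ⟩
    length L * (suc d * D)  ∎
    where
    open ≤-Reasoning
    L = petals S (edges H)
    W = concatMap (extensions S) L

    ∣W∣ : All (λ T → ∣ T ∣ ≡ suc ∣ S ∣) W
    ∣W∣ = All.concat⁺ (All.map⁺ (All.universal (∣extensions∣ S) L))

    length-extension-petal : ∀ {E} → S ⊆ E × ∣ E ∣ ≡ k → length (extensions S E) ≡ suc d
    length-extension-petal {E} (S⊆E , ∣E∣≡k) = +-cancelʳ-≡ ∣ S ∣ _ _ (begin-equality
      length (extensions S E) + ∣ S ∣  ≡⟨ trans (length-extensions S⊆E) ∣E∣≡k ⟩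
      k                                ≡⟨ sym ∣S∣+d+1≡k ⟩
      ∣ S ∣ + suc d                    ≡⟨ +-comm ∣ S ∣ (suc d) ⟩
      suc d + ∣ S ∣                    ∎)

    covers : ∀ {F} → (S ⊆ F → F ≢ S → Any (λ E → F ∩ E ≢ S) L) × ∣ F ∣ ≡ k →
             S ⊆ F → Any (_⊆ F) W
    covers {F} (maximal , ∣F∣≡k) S⊆F =
      let E , E∈L , F∩E≢S = find (maximal S⊆F F≢S)
      in Any.concat⁺ (Any.map⁺ (lose E∈L
           (extension-⊆ (All.lookup (⊆-petals S (edges H)) E∈L) S⊆F F∩E≢S)))
      where
      F≢S : F ≢ S
      F≢S F≡S = m+1+n≢m ∣ S ∣ (trans ∣S∣+d+1≡k (trans (sym ∣F∣≡k) (cong ∣_∣ F≡S)))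

    covered : All (λ F → S ⊆ F → Any (_⊆ F) W) (edges H)
    covered = All.zipWith covers (petals-maximal S (edges H) , uniform H)

degreeBound : (ℕ → ℕ) → ℕ → ℕ
degreeBound lam zero    = 1
degreeBound lam (suc j) = lam (suc j) * (suc j * degreeBound lam j)

suc-*-degreeBound : ∀ lam j → suc j * degreeBound lam j ≡ prodFactor lam j
suc-*-degreeBound lam zero    = refl
suc-*-degreeBound lam (suc j) = begin
  suc (suc j) * (lam (suc j) * (suc j * degreeBound lam j))
    ≡⟨ rearrange (suc j) (lam (suc j)) (degreeBound lam j) ⟩
  suc j * degreeBound lam j * (suc (suc j) * lam (suc j))
    ≡⟨ cong (_* (suc (suc j) * lam (suc j))) (suc-*-degreeBound lam j) ⟩
  prodFactor lam j * (suc (suc j) * lam (suc j))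
    ∎
  where
  open ≡-Reasoning
  rearrange : ∀ a l q → suc a * (l * (a * q)) ≡ a * q * (suc a * l)
  rearrange = solve-∀

module _ {k n} (H : KGraph k n) (lam : ℕ → ℕ)
         (sunflower-free : ∀ i → 1 ≤ i → i ≤ k ∸ 1 → ¬ HasSunflower H (lam i) (k ∸ i)) where

  length-petals< : ∀ i → 1 ≤ i → i ≤ k ∸ 1 → ∀ S → ∣ S ∣ ≡ k ∸ i →
                   length (petals S (edges H)) < lam i
  length-petals< i 1≤i i≤k-1 S ∣S∣≡k-i with lam i ≤? length (petals S (edges H))
  ... | no  petals≱lam = ≰⇒> petals≱lam
  ... | yes lam≤petals = ⊥-elim (sunflower-free i 1≤i i≤k-1
          (S , take (lam i) L , ∣S∣≡k-i , trans (length-take (lam i) L) (m≤n⇒m⊓n≡m lam≤petals)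
             , All.take⁺ (lam i) (All-petals S (All.tabulate id))
             , AllPairs.take⁺ (lam i) (petals-sunflower S (edges H))))
    where
    L = petals S (edges H)

  degree-≤-degreeBound : ∀ j → j ≤ k ∸ 1 → ∀ S → ∣ S ∣ + j ≡ k → degree H S ≤ degreeBound lam j
  degree-≤-degreeBound zero    _       S ∣S∣+0≡k =
    degree-≤-1 H S (trans (sym (+-identityʳ ∣ S ∣)) ∣S∣+0≡k)
  degree-≤-degreeBound (suc j) j+1≤k-1 S ∣S∣+j+1≡k = begin
    degree H S
      ≤⟨ degree-≤-petals H S j ∣S∣+j+1≡k degree-of-extension ⟩
    length (petals S (edges H)) * (suc j * degreeBound lam j)
      ≤⟨ *-monoˡ-≤ _ (<⇒≤ (length-petals< (suc j) (s≤s z≤n) j+1≤k-1 S ∣S∣≡k-j-1)) ⟩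
    lam (suc j) * (suc j * degreeBound lam j)
      ∎
    where
    open ≤-Reasoning
    ∣S∣≡k-j-1 : ∣ S ∣ ≡ k ∸ suc j
    ∣S∣≡k-j-1 = sym (trans (cong (_∸ suc j) (sym ∣S∣+j+1≡k)) (m+n∸n≡m ∣ S ∣ (suc j)))
    degree-of-extension : ∀ T → ∣ T ∣ ≡ suc ∣ S ∣ → degree H T ≤ degreeBound lam j
    degree-of-extension T ∣T∣≡∣S∣+1 = degree-≤-degreeBound j (≤-trans (n≤1+n j) j+1≤k-1) T
      (trans (cong (_+ j) ∣T∣≡∣S∣+1) (trans (sym (+-suc ∣ S ∣ j)) ∣S∣+j+1≡k))

lemma3p1 : (k n : ℕ) → 2 ≤ k → (lam : ℕ → ℕ)
    → (∀ i → 1 ≤ i → i ≤ k ∸ 1 → 1 ≤ lam i)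
    → (H : KGraph k n)
    → (∀ i → 1 ≤ i → i ≤ k ∸ 1 → ¬ HasSunflower H (lam i) (k ∸ i))
    → Σ ℕ λ t → HasMatchingOfSize H t × numEdges H ≤ t * prodFactor lam (k ∸ 1)
lemma3p1 k n 2≤k lam _ H sunflower-free =
  length M , (M , refl , All-petals ⊥ (All.tabulate id) , petals-sunflower ⊥ (edges H)) , (begin
    numEdges H
      ≡⟨ cong length (filter-all (⊥ ⊆?_) (All.universal ⊆-min (edges H))) ⟨
    degree H ⊥
      ≤⟨ degree-≤-petals H ⊥ (k ∸ 1) ∣⊥∣+k≡k degree-of-singleton ⟩
    length M * (suc (k ∸ 1) * degreeBound lam (k ∸ 1))
      ≡⟨ cong (length M *_) (suc-*-degreeBound lam (k ∸ 1)) ⟩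
    length M * prodFactor lam (k ∸ 1)
      ∎)
  where
  open ≤-Reasoning
  M = petals ⊥ (edges H)

  1+[k∸1]≡k : suc (k ∸ 1) ≡ k
  1+[k∸1]≡k = m+[n∸m]≡n (<⇒≤ 2≤k)

  ∣⊥∣+k≡k : ∣ ⊥ {n} ∣ + suc (k ∸ 1) ≡ k
  ∣⊥∣+k≡k = trans (cong (_+ suc (k ∸ 1)) (∣⊥∣≡0 n)) 1+[k∸1]≡k

  degree-of-singleton : ∀ T → ∣ T ∣ ≡ suc ∣ ⊥ {n} ∣ → degree H T ≤ degreeBound lam (k ∸ 1)
  degree-of-singleton T ∣T∣≡1 = degree-≤-degreeBound H lam sunflower-free (k ∸ 1) ≤-refl T
    (trans (cong (_+ (k ∸ 1)) (trans ∣T∣≡1 (cong suc (∣⊥∣≡0 n)))) 1+[k∸1]≡k)
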